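{- Let $G$ be a connected graph with at least two vertices. Then $$q(G)\le\max_{uv\in E(G)}\min\left\{\frac{d(u)}{d[u]},\ \frac{d(v)}{d[v]}\right\}.$$
   Context: All graphs are finite, simple and undirected. For a vertex $v$, $d(v)$ is its degree, $N[v]$ its closed neighbourhood and $d[v]=d(v)+1$. A partition of $G$ is a pair $(V_1,V_2)$ of nonempty disjoint sets with union $V(G)$; for $v\in V_i$, $q^i(v)=|N[v]\cap V_i|/d[v]$, and $q(G)=\max_{(V_1,V_2)}\min\{q^i(v): i\in\{1,2\}, v\in V_i\}$ over all partitions. -}

module Defs where

open import Data.Nat using (ℕ; zero; suc; _+_)
open import Data.Fin using (Fin; _≟_)
open import Data.Bool using (Bool; true; false; _∧_; _∨_; if_then_else_; not)
open import Data.Bool.Properties using () renaming (_≟_ to _≟ᵇ_)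
open import Data.List using (List; []; _∷_; map; foldr; filter; concatMap; allFin)
open import Data.Vec using (Vec; []; _∷_; lookup)
open import Data.Integer using (+_)
open import Data.Rational using (ℚ; _/_; _⊔_; _⊓_; 0ℚ; 1ℚ)
open import Relation.Nullary.Decidable using (⌊_⌋)
open import Relation.Binary.PropositionalEquality using (_≡_)
open import Data.Product using (_×_; _,_; proj₁; proj₂)
open import Data.Bool.ListAction using (any)

record Graph (n : ℕ) : Set where
  field
    adj    : Fin n → Fin n → Bool
    sym    : ∀ u v → adj u v ≡ adj v u
    irrefl : ∀ v → adj v v ≡ false
open Graph public

count : ∀ {n} → (Fin n → Bool) → ℕ
count {n} p = foldr (λ v k → if p v then suc k else k) 0 (allFin n)

deg : ∀ {n} → Graph n → Fin n → ℕ
deg G v = count (adj G v)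

cdeg : ∀ {n} → Graph n → Fin n → ℕ
cdeg G v = suc (deg G v)

inN : ∀ {n} → Graph n → Fin n → Fin n → Bool
inN G v w = ⌊ v ≟ w ⌋ ∨ adj G v w

data Reach {n} (G : Graph n) : Fin n → Fin n → Set where
  here : ∀ {v} → Reach G v v
  step : ∀ {u w v} → adj G u w ≡ true → Reach G w v → Reach G u v

Connected : ∀ {n} → Graph n → Set
Connected {n} G = ∀ (u v : Fin n) → Reach G u v

-- A bipartition of the vertex set is encoded by S : Vec Bool n,
-- V₁ = {v | S[v] = true}, V₂ = {v | S[v] = false}.
allSubsets : (n : ℕ) → List (Vec Bool n)
allSubsets zero = [] ∷ []
allSubsets (suc n) = concatMap (λ s → (true ∷ s) ∷ (false ∷ s) ∷ []) (allSubsets n)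

isPartition : ∀ {n} → Vec Bool n → Bool
isPartition S = any (λ v → lookup S v) (allFin _)
              ∧ any (λ v → not (lookup S v)) (allFin _)

partitions : (n : ℕ) → List (Vec Bool n)
partitions n = filter (λ S → isPartition S ≟ᵇ true) (allSubsets n)

qv : ∀ {n} → Graph n → Vec Bool n → Fin n → ℚ
qv G S v = (+ count (λ w → inN G v w ∧ ⌊ lookup S w ≟ᵇ lookup S v ⌋)) / cdeg G v

-- min over vertices (default 1 for the empty vertex set; all values ≤ 1)
minOver : ∀ {n} → (Fin n → ℚ) → ℚ
minOver {n} f = foldr (λ v r → f v ⊓ r) 1ℚ (allFin n)

-- max over a list (default 0; all values used are ≥ 0)
maxList : List ℚ → ℚ
maxList = foldr _⊔_ 0ℚ

qPart : ∀ {n} → Graph n → Vec Bool n → ℚ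
qPart G S = minOver (qv G S)

q : ∀ {n} → Graph n → ℚ
q {n} G = maxList (map (qPart G) (partitions n))

ratio : ∀ {n} → Graph n → Fin n → ℚ
ratio G v = (+ deg G v) / cdeg G v

edges : ∀ {n} → Graph n → List (Fin n × Fin n)
edges {n} G = filter (λ p → adj G (proj₁ p) (proj₂ p) ≟ᵇ true)
                (concatMap (λ u → map (λ v → (u , v)) (allFin n)) (allFin n))

edgeBound : ∀ {n} → Graph n → ℚ
edgeBound G = maxList (map (λ p → ratio G (proj₁ p) ⊓ ratio G (proj₂ p)) (edges G))

-- A connected graph has, for every partition (V₁ , V₂), an edge uv with u ∈ V₁ and v ∈ V₂.
-- The closed neighbourhood of u then contains v ∉ V₁, so |N[u] ∩ V₁| ≤ d[u] − 1 = d(u), i.e.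
-- q¹(u) ≤ d(u)/d[u]; likewise q²(v) ≤ d(v)/d[v]. Hence the value of the partition is at most
-- min{d(u)/d[u], d(v)/d[v]} for this edge, which is bounded by the maximum over all edges.
module Submission where

open import Defs
open import Data.Nat as ℕ using (ℕ; zero; suc; s≤s; _≥_)
import Data.Nat.Properties as ℕ
open import Data.Fin using (Fin; _≟_) renaming (zero to fzero; suc to fsuc)
open import Data.Bool using (Bool; true; false; _∧_; _∨_; if_then_else_)
open import Data.Bool.Properties
  using (T-≡; T-not-≡; T-∧; ∧-conicalˡ; ∧-zeroʳ; ∨-zeroʳ) renaming (_≟_ to _≟ᵇ_)
open import Data.List using (map; tabulate; foldr; allFin)
open import Data.List.Properties
  using (foldr-map; map-tabulate; foldr-preservesᵇ; foldr-preservesʳ; foldr-preservesᵒ)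
open import Data.List.Relation.Unary.All as All using (All)
open import Data.List.Relation.Unary.All.Properties using (all-filter)
import Data.List.Relation.Unary.All.Properties as All
open import Data.List.Relation.Unary.Any as Any using (satisfied)
open import Data.List.Relation.Unary.Any.Properties using (any⁻)
open import Data.List.Membership.Propositional using (_∈_)
open import Data.List.Membership.Propositional.Properties
  using (∈-map⁺; ∈-filter⁺; ∈-allFin; ∈-concatMap⁺)
open import Data.Vec using (Vec; lookup)
open import Data.Integer using (+_; +≤+)
import Data.Integer.Properties as ℤ
open import Data.Rational using (ℚ; _≤_; _/_; _⊓_; 0ℚ; 1ℚ)
open import Data.Rational.Properties
  using ( toℚᵘ-cancel-≤; toℚᵘ-fromℚᵘ; ≤-refl; ≤-reflexive; ⊔-lub; ⊓-glb; ⊓-mono-≤; module ≤-Reasoning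
        ; p≤q⇒p≤q⊔r; p≤q⇒p≤r⊔q; p≤q⇒p⊓r≤q; p≤q⇒r⊓p≤q )
import Data.Rational.Unnormalised as ℚᵘ
import Data.Rational.Unnormalised.Properties as ℚᵘ
open import Data.Product using (_×_; _,_; proj₁; proj₂; ∃₂)
open import Data.Sum using (inj₂; [_,_])
open import Function using (_∘_)
open import Function.Bundles using (Equivalence)
open import Relation.Binary.Definitions using (DecidableEquality)
open import Relation.Nullary using (yes; no; contradiction)
open import Relation.Nullary.Decidable using (⌊_⌋; fromWitnessFalse)
open import Relation.Binary.PropositionalEquality
  using (_≡_; refl; trans; cong; subst; _≢_; module ≡-Reasoning)
  renaming (sym to ≡-sym)

open Equivalence using (to; from)

private
  variable
    n : ℕ

_⊆ᵇ_ : (p r : Fin n → Bool) → Set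
p ⊆ᵇ r = ∀ w → p w ≡ true → r w ≡ true

insert : Fin n → (Fin n → Bool) → Fin n → Bool
insert a p w = ⌊ a ≟ w ⌋ ∨ p w

count-suc : (p : Fin (suc n) → Bool) →
            count p ≡ (if p fzero then suc (count (λ w → p (fsuc w))) else count (λ w → p (fsuc w)))
count-suc {n} p = cong (λ k → if p fzero then suc k else k) (begin
  foldr tally 0 (tabulate fsuc)        ≡⟨ cong (foldr tally 0) (map-tabulate (λ w → w) fsuc) ⟨
  foldr tally 0 (map fsuc (allFin n))  ≡⟨ foldr-map tally fsuc 0 (allFin n) ⟩
  count (λ w → p (fsuc w))             ∎)
  where
  open ≡-Reasoning
  tally : Fin (suc n) → ℕ → ℕ
  tally v k = if p v then suc k else k

count-mono : (p r : Fin n → Bool) → p ⊆ᵇ r → count p ℕ.≤ count r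
count-mono {zero}  p r p⊆r = ℕ.z≤n
count-mono {suc n} p r p⊆r
  rewrite count-suc p | count-suc r
  with p fzero | r fzero | p⊆r fzero
... | true  | true  | _  = s≤s (count-mono _ _ (p⊆r ∘ fsuc))
... | true  | false | p₀ = contradiction (p₀ refl) λ ()
... | false | true  | _  = ℕ.m≤n⇒m≤1+n (count-mono _ _ (p⊆r ∘ fsuc))
... | false | false | _  = count-mono _ _ (p⊆r ∘ fsuc)

count-cong : (p r : Fin n → Bool) → (∀ w → p w ≡ r w) → count p ≡ count r
count-cong p r p≗r = ℕ.≤-antisym
  (count-mono p r (λ w e → trans (≡-sym (p≗r w)) e))
  (count-mono r p (λ w e → trans (p≗r w) e))

count-insert : (a : Fin n) (p : Fin n → Bool) → p a ≡ false → count (insert a p) ≡ suc (count p)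
count-insert {suc n} fzero p pa
  rewrite count-suc (insert fzero p) | count-suc p | pa = refl
count-insert {suc n} (fsuc a) p pa = begin
  count (insert (fsuc a) p)                        ≡⟨ count-suc (insert (fsuc a) p) ⟩
  add (p fzero) (count (insert (fsuc a) p ∘ fsuc)) ≡⟨ cong (add (p fzero)) (count-cong _ _ insert-fsuc) ⟩
  add (p fzero) (count (insert a (p ∘ fsuc)))      ≡⟨ cong (add (p fzero)) (count-insert a (p ∘ fsuc) pa) ⟩
  add (p fzero) (suc (count (p ∘ fsuc)))           ≡⟨ add-suc (p fzero) ⟩
  suc (add (p fzero) (count (p ∘ fsuc)))           ≡⟨ cong suc (count-suc p) ⟨
  suc (count p)                                    ∎
  where
  open ≡-Reasoning
  add : Bool → ℕ → ℕ
  add b k = if b then suc k else k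
  add-suc : ∀ b {k} → add b (suc k) ≡ suc (add b k)
  add-suc true  = refl
  add-suc false = refl
  -- ⌊ fsuc a ≟ fsuc w ⌋ only reduces to ⌊ a ≟ w ⌋ once a ≟ w is evaluated.
  insert-fsuc : ∀ w → insert (fsuc a) p (fsuc w) ≡ insert a (p ∘ fsuc) w
  insert-fsuc w with a ≟ w
  ... | yes _ = refl
  ... | no _  = refl

count-mono-< : (p r : Fin n → Bool) → p ⊆ᵇ r →
               (b : Fin n) → p b ≡ false → r b ≡ true → count p ℕ.< count r
count-mono-< p r p⊆r b pb rb = begin-strict
  count p                <⟨ ℕ.n<1+n (count p) ⟩
  suc (count p)          ≡⟨ count-insert b p pb ⟨
  count (insert b p)     ≤⟨ count-mono (insert b p) r insert⊆r ⟩
  count r                ∎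
  where
  open ℕ.≤-Reasoning
  insert⊆r : insert b p ⊆ᵇ r
  insert⊆r w e with b ≟ w
  ... | yes refl = rb
  ... | no _     = p⊆r w e

count-inN : (G : Graph n) (v : Fin n) → count (inN G v) ≡ cdeg G v
count-inN G v = count-insert v (adj G v) (irrefl G v)

count-sameSide<cdeg : (G : Graph n) (S : Vec Bool n) {v w : Fin n} →
                      adj G v w ≡ true → lookup S w ≢ lookup S v →
                      count (λ x → inN G v x ∧ ⌊ lookup S x ≟ᵇ lookup S v ⌋) ℕ.< cdeg G v
count-sameSide<cdeg G S {v} {w} vw Sw≢Sv =
  subst (count sameSide ℕ.<_) (count-inN G v)
    (count-mono-< sameSide (inN G v) sameSide⊆N[v] w w∉sameSide w∈N[v])
  where
  sameSide : Fin _ → Bool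
  sameSide x = inN G v x ∧ ⌊ lookup S x ≟ᵇ lookup S v ⌋
  sameSide⊆N[v] : sameSide ⊆ᵇ inN G v
  sameSide⊆N[v] x = ∧-conicalˡ _ _
  w∉sameSide : sameSide w ≡ false
  w∉sameSide = trans (cong (inN G v w ∧_) (to T-not-≡ (fromWitnessFalse Sw≢Sv))) (∧-zeroʳ _)
  w∈N[v] : inN G v w ≡ true
  w∈N[v] = trans (cong (⌊ v ≟ w ⌋ ∨_) vw) (∨-zeroʳ _)

/-monoˡ-≤ : ∀ {a b} m → a ℕ.≤ b → (+ a) / suc m ≤ (+ b) / suc m
/-monoˡ-≤ {a} {b} m a≤b = toℚᵘ-cancel-≤
  (ℚᵘ.≤-respˡ-≃ (ℚᵘ.≃-sym (toℚᵘ-fromℚᵘ (ℚᵘ.mkℚᵘ (+ a) m)))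
    (ℚᵘ.≤-respʳ-≃ (ℚᵘ.≃-sym (toℚᵘ-fromℚᵘ (ℚᵘ.mkℚᵘ (+ b) m)))
      (ℚᵘ.*≤* (ℤ.*-monoʳ-≤-nonNeg (+ suc m) (+≤+ a≤b)))))

qv≤ratio : (G : Graph n) (S : Vec Bool n) {v w : Fin n} →
           adj G v w ≡ true → lookup S w ≢ lookup S v → qv G S v ≤ ratio G v
qv≤ratio G S {v} vw Sw≢Sv = /-monoˡ-≤ (deg G v) (ℕ.s≤s⁻¹ (count-sameSide<cdeg G S vw Sw≢Sv))

minOver≤ : (f : Fin n → ℚ) (v : Fin n) → minOver f ≤ f v
minOver≤ {n} f v = subst (_≤ f v) (foldr-map _⊓_ f 1ℚ (allFin n))
  (foldr-preservesᵒ {P = _≤ f v} (λ x y → [ p≤q⇒p⊓r≤q y , p≤q⇒r⊓p≤q x ]) 1ℚ (map f (allFin n))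
    (inj₂ (Any.map (≤-reflexive ∘ ≡-sym) (∈-map⁺ f (∈-allFin v)))))

≤maxList : ∀ {x xs} → x ∈ xs → x ≤ maxList xs
≤maxList {x} {xs} x∈xs =
  foldr-preservesᵒ {P = x ≤_} (λ y z → [ p≤q⇒p≤q⊔r z , p≤q⇒p≤r⊔q y ]) 0ℚ xs
    (inj₂ (Any.map ≤-reflexive x∈xs))

0≤maxList : ∀ xs → 0ℚ ≤ maxList xs
0≤maxList = foldr-preservesʳ {P = 0ℚ ≤_} (λ x → p≤q⇒p≤r⊔q x) ≤-refl

maxList≤ : ∀ {xs B} → All (_≤ B) xs → 0ℚ ≤ B → maxList xs ≤ B
maxList≤ xs≤B 0≤B = foldr-preservesᵇ ⊔-lub 0≤B xs≤B

crossing-edge : {A : Set} → DecidableEquality A → (G : Graph n) (c : Fin n → A) {a b : Fin n} →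
                Reach G a b → c a ≢ c b → ∃₂ λ u w → adj G u w ≡ true × c u ≢ c w
crossing-edge eq? G c here           ca≢cb = contradiction refl ca≢cb
crossing-edge eq? G c (step {u} {w} uw w⇝b) cu≢cb with eq? (c u) (c w)
... | yes cu≡cw = crossing-edge eq? G c w⇝b (cu≢cb ∘ trans cu≡cw)
... | no  cu≢cw = u , w , uw , cu≢cw

edge∈edges : (G : Graph n) {u w : Fin n} → adj G u w ≡ true → (u , w) ∈ edges G
edge∈edges {n} G {u} {w} uw = ∈-filter⁺ (λ e → adj G (proj₁ e) (proj₂ e) ≟ᵇ true)
  (∈-concatMap⁺ (λ x → map (x ,_) (allFin n))
    (Any.map (λ { refl → ∈-map⁺ (u ,_) (∈-allFin w) }) (∈-allFin u)))
  uw

partition-sides : (S : Vec Bool n) → isPartition S ≡ true → ∃₂ λ a b → lookup S a ≢ lookup S b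
partition-sides {n} S S-part with to T-∧ (from T-≡ S-part)
... | some-true , some-false with satisfied (any⁻ _ (allFin n) some-true)
                                | satisfied (any⁻ _ (allFin n) some-false)
... | a , Sa | b , Sb = a , b , λ Sa≡Sb →
  contradiction (trans (≡-sym (to T-≡ Sa)) (trans Sa≡Sb (to T-not-≡ Sb))) λ ()

qPart≤edgeBound : (G : Graph n) → Connected G → (S : Vec Bool n) → isPartition S ≡ true →
                  qPart G S ≤ edgeBound G
qPart≤edgeBound G conn S S-part with partition-sides S S-part
... | a , b , Sa≢Sb with crossing-edge _≟ᵇ_ G (lookup S) (conn a b) Sa≢Sb
... | u , w , uw , Su≢Sw = begin
  qPart G S               ≤⟨ ⊓-glb (minOver≤ (qv G S) u) (minOver≤ (qv G S) w) ⟩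
  qv G S u ⊓ qv G S w     ≤⟨ ⊓-mono-≤ (qv≤ratio G S uw (Su≢Sw ∘ ≡-sym)) (qv≤ratio G S wu Su≢Sw) ⟩
  ratio G u ⊓ ratio G w   ≤⟨ ≤maxList (∈-map⁺ edgeValue (edge∈edges G uw)) ⟩
  edgeBound G             ∎
  where
  open ≤-Reasoning
  edgeValue : Fin _ × Fin _ → ℚ
  edgeValue (x , y) = ratio G x ⊓ ratio G y
  wu : adj G w u ≡ true
  wu = trans (Graph.sym G w u) uw

lemma1 : ∀ (n : ℕ) (G : Graph n) → n ≥ 2 → Connected G → q G ≤ edgeBound G
lemma1 n G _ conn =
  maxList≤ (All.map⁺ (All.map (λ {S} → qPart≤edgeBound G conn S) partitions-are-partitions))
           (0≤maxList (map (λ e → ratio G (proj₁ e) ⊓ ratio G (proj₂ e)) (edges G)))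
  where
  partitions-are-partitions : All (λ S → isPartition S ≡ true) (partitions n)
  partitions-are-partitions = all-filter (λ S → isPartition S ≟ᵇ true) (allSubsets n)
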